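{- For every $n \geq 1$, the image $\rho(\mathsf{F}(n))$ equals $\mathsf{Tr}(n)$ (and $\rho$ is a bijection from $\mathsf{F}(n)$ onto $\mathsf{Tr}(n)$).
   Context: Dyck paths: a Dyck path of size $m$ is encoded as a word of length $2m$ over $\{0,1\}$ ($1$ = up step, $0$ = down step) with equally many $1$s and $0$s and every prefix having at least as many $1$s as $0$s; $\mathsf{Dy}(m)$ is the set of them. A Dyck path is primitive if it is not a concatenation $xy$ of two nonempty Dyck paths. A factor $x$ of $d$ that is a Dyck path is movable if $x$ is primitive and $d = p\,1\,0^{m}\,x\,s$ with $m>0$ and $s$ empty or beginning with $1$. Dexter order: if $d = p\,1\,0^m\,x\,s$ with $x$ movable, then $d$ is covered by every $p\,1\,0^{\alpha}\,x\,0^{\beta}\,s$ with $\alpha+\beta = m$, $\beta>0$; $\preccurlyeq_{\mathsf{Dex}}$ is the reflexive-transitive closure. $\mathsf{F}(n)$ is the interval of $(\mathsf{Dy}(n+2),\preccurlyeq_{\mathsf{Dex}})$ between $1100(10)^n$ and $1\,1^n0^n\,100$. A valley is a factor $01$; its height is the number of $1$s minus the number of $0$s in the prefix ending with that $0$. The map $\rho$: read $d\in\mathsf{F}(n)$ left to right with a counter $N_2=0$ and output $u=\epsilon$; each time a factor $11$ is read, except the one formed by the first two letters, add $1$ to $N_2$; each time a valley of height $h$ is read, append $h\,2^{N_2}$ to $u$ and reset $N_2=0$; $\rho(d)$ is the final $u$. $\mathsf{Tr}(n)$ is the set of words $u_1\cdots u_n$ over $\{0,1,2\}$ with $u_1\neq2$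 and no $i<j$ with $u_i=0$, $u_j=1$. -}

module Defs where

open import Data.Bool using (Bool; true; false)
open import Data.Nat using (ℕ; zero; suc; _+_; _*_; _∸_; _≤_; _<_)
open import Data.List using (List; []; _∷_; _++_; replicate; length; lookup)
open import Data.List.Relation.Unary.All using (All)
open import Data.Fin using (Fin) renaming (_<_ to _<ᶠ_)
open import Data.Product using (Σ; ∃; _×_; _,_)
open import Data.Sum using (_⊎_)
open import Data.Empty using (⊥)
open import Relation.Binary.PropositionalEquality using (_≡_; _≢_)
open import Relation.Binary.Construct.Closure.ReflexiveTransitive using (Star)

-- Words over {0,1}: true = 1 (up step), false = 0 (down step).
Word : Set
Word = List Bool

data DyckFrom : ℕ → Word → Set where
  done : DyckFrom 0 []
  up   : ∀ {h w} → DyckFrom (suc h) w → DyckFrom h (true ∷ w)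
  down : ∀ {h w} → DyckFrom h w → DyckFrom (suc h) (false ∷ w)

IsDyck : Word → Set
IsDyck w = DyckFrom 0 w

InDy : ℕ → Word → Set
InDy m d = IsDyck d × length d ≡ 2 * m

Primitive : Word → Set
Primitive x = IsDyck x ×
  (∀ (y z : Word) → x ≡ y ++ z → IsDyck y → IsDyck z → y ≢ [] → z ≢ [] → ⊥)

EmptyOrStartsUp : Word → Set
EmptyOrStartsUp s = s ≡ [] ⊎ ∃ λ s' → s ≡ true ∷ s'

data DexCover (d d' : Word) : Set where
  cover : (p x s : Word) (m α β : ℕ) →
          0 < m → Primitive x → EmptyOrStartsUp s →
          α + β ≡ m → 0 < β →
          d  ≡ p ++ true ∷ (replicate m false ++ x ++ s) →
          d' ≡ p ++ true ∷ (replicate α false ++ x ++ replicate β false ++ s) →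
          DexCover d d'

_≼Dex_ : Word → Word → Set
d ≼Dex d' = Star DexCover d d'

tens : ℕ → Word
tens zero = []
tens (suc n) = true ∷ false ∷ tens n

botF : ℕ → Word
botF n = true ∷ true ∷ false ∷ false ∷ tens n

topF : ℕ → Word
topF n = true ∷ (replicate n true ++ replicate n false ++ true ∷ false ∷ false ∷ [])

InF : ℕ → Word → Set
InF n d = InDy (n + 2) d × botF n ≼Dex d × d ≼Dex topF n

-- the map ρ.  go prev h N₂ w : prev = last letter read, h = current height,
-- N₂ = current counter.
step : Bool → ℕ → ℕ
step true h = suc h
step false h = h ∸ 1

go : Bool → ℕ → ℕ → Word → List ℕ
go prev h n2 [] = []
go true  h n2 (true ∷ w)  = go true (suc h) (suc n2) w
go false h n2 (true ∷ w)  = h ∷ (replicate n2 2 ++ go true (suc h) 0 w)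
go prev  h n2 (false ∷ w) = go false (h ∸ 1) n2 w

ρ : Word → List ℕ
ρ [] = []
ρ (true ∷ true ∷ w) = go true 2 0 w     -- first factor 11 is not counted
ρ (b ∷ w) = go b (step b 0) 0 w

InTr : ℕ → List ℕ → Set
InTr n u = length u ≡ n × All (λ a → a ≤ 2) u × (∀ w → u ≢ 2 ∷ w) ×
  (∀ (i j : Fin (length u)) → i <ᶠ j → lookup u i ≡ 0 → lookup u j ≡ 1 → ⊥)

module Submission where

-- After its first letters 11, a path d ∈ F(n) is described by
-- its tokens: each later up step is a rise (it follows an up step) or a valley
-- of some height (it follows a down step).  ρ only reads the tokens
-- (ρ = encode ∘ tokens), and path rebuilds a Dyck path from its tokens.
-- (1) Call a token list good when its valley heights decrease weakly from at
--     most 1 and its last token is a valley.  The tokens of the top element are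
--     good and goodness goes down along every Dexter cover, so every d ∈ F(n)
--     has good tokens; encode maps good token lists of length n into Tr(n).
-- (2) On good token lists encode has a left inverse decode, so ρ is injective.
-- (3) Every u ∈ Tr(n) encodes blocks of rises closed by valleys at height 1
--     followed by blocks closed by valleys at height 0.  Chains of two kinds of
--     covers (merging two equal valleys, raising a valley from 0 to 1) lead
--     from the bottom 1100(10)ⁿ to the corresponding path and on to the top.

open import Defs
open import Data.Nat using (ℕ; _≤_)
open import Data.List using (List)
open import Data.Product using (∃; _×_)
open import Relation.Binary.PropositionalEquality using (_≡_)

open import Data.Bool using (Bool; true; false) renaming (T to IsTrue)
open import Data.Empty using (⊥; ⊥-elim)
open import Data.Fin using (Fin) renaming (zero to fzero; suc to fsuc; _<_ to _<ᶠ_)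
open import Data.List using ([]; _∷_; _++_; replicate; length; lookup; map)
open import Data.List.Properties using (++-assoc; ++-identityʳ; length-++; length-replicate; ∷-injectiveʳ)
open import Data.List.Relation.Unary.All using (All; []; _∷_)
import Data.List.Relation.Unary.All as All
open import Data.List.Relation.Unary.All.Properties using (++⁺; replicate⁺)
open import Data.Nat using (zero; suc; _+_; _*_; _∸_; _<_; z≤n; s≤s)
open import Data.Nat.Properties
open import Data.Product using (∃₂; _,_; proj₂)
open import Data.Sum using (_⊎_; inj₁; inj₂)
open import Data.Unit using (⊤)
open import Function using (_∘_)
open import Relation.Binary.PropositionalEquality using (refl; sym; trans; cong; cong₂; subst; subst₂; _≢_; module ≡-Reasoning)
open import Relation.Binary.Construct.Closure.ReflexiveTransitive using (ε; _◅_; _◅◅_)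

open ≡-Reasoning

replicate-snoc : ∀ {A : Set} n (x : A) (w : List A) → replicate n x ++ x ∷ w ≡ x ∷ replicate n x ++ w
replicate-snoc zero    x w = refl
replicate-snoc (suc n) x w = cong (x ∷_) (replicate-snoc n x w)

replicate-++ : ∀ {A : Set} m n (x : A) (w : List A) → replicate m x ++ replicate n x ++ w ≡ replicate (m + n) x ++ w
replicate-++ zero    n x w = refl
replicate-++ (suc m) n x w = cong (x ∷_) (replicate-++ m n x w)

-- The up steps of a path after its first letter: a rise follows an up step,
-- a valley h follows a down step that ended at height h.
data Tok : Set where
  rise   : Tok
  valley : ℕ → Tok

tokens : Bool → ℕ → Word → List Tok
tokens b     h []          = []
tokens true  h (true ∷ w)  = rise ∷ tokens true (suc h) w
tokens false h (true ∷ w)  = valley h ∷ tokens true (suc h) w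
tokens b     h (false ∷ w) = tokens false (h ∸ 1) w

-- encode j T: the output of ρ on the tokens T while j rises are pending.
encode : ℕ → List Tok → List ℕ
encode j []             = []
encode j (rise ∷ T)     = encode (suc j) T
encode j (valley h ∷ T) = h ∷ (replicate j 2 ++ encode 0 T)

go-encode : ∀ b h j w → go b h j w ≡ encode j (tokens b h w)
go-encode b     h j []          = refl
go-encode true  h j (true ∷ w)  = go-encode true (suc h) (suc j) w
go-encode false h j (true ∷ w)  = cong (λ r → h ∷ (replicate j 2 ++ r)) (go-encode true (suc h) 0 w)
go-encode true  h j (false ∷ w) = go-encode false (h ∸ 1) j w
go-encode false h j (false ∷ w) = go-encode false (h ∸ 1) j w

path : ℕ → List Tok → Word
path h []             = replicate h false
path h (rise ∷ T)     = true ∷ path (suc h) T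
path h (valley v ∷ T) = replicate (h ∸ v) false ++ true ∷ path (suc v) T

height : ℕ → List Tok → ℕ
height h []             = h
height h (rise ∷ T)     = height (suc h) T
height h (valley v ∷ T) = height (suc v) T

height-++ : ∀ h A B → height h (A ++ B) ≡ height (height h A) B
height-++ h []             B = refl
height-++ h (rise ∷ A)     B = height-++ (suc h) A B
height-++ h (valley v ∷ A) B = height-++ (suc v) A B

height-pos : ∀ h A → 1 ≤ height (suc h) A
height-pos h []             = s≤s z≤n
height-pos h (rise ∷ A)     = height-pos (suc h) A
height-pos h (valley v ∷ A) = height-pos v A

height-rises : ∀ h k → height h (replicate k rise) ≡ k + h
height-rises h zero    = refl
height-rises h (suc k) = trans (height-rises (suc h) k) (+-suc k h)

height-valleys : ∀ h v l → height h (replicate (suc l) (valley v)) ≡ suc v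
height-valleys h v zero    = refl
height-valleys h v (suc l) = height-valleys (suc v) v l

path-rises : ∀ h k T → path h (replicate k rise ++ T) ≡ replicate k true ++ path (k + h) T
path-rises h zero    T = refl
path-rises h (suc k) T = cong (true ∷_) (trans (path-rises (suc h) k T) (cong (λ j → replicate k true ++ path j T) (+-suc k h)))

path-split : ∀ h A → ∃ λ p → ∀ X → true ∷ path h (A ++ X) ≡ p ++ true ∷ path (height h A) X
path-split h [] = [] , λ X → refl
path-split h (rise ∷ A) with path-split (suc h) A
... | p , split = true ∷ p , λ X → cong (true ∷_) (split X)
path-split h (valley v ∷ A) with path-split (suc v) A
... | p , split = true ∷ replicate (h ∸ v) false ++ p , λ X →
  trans (cong (λ w → true ∷ replicate (h ∸ v) false ++ w) (split X))
        (cong (true ∷_) (sym (++-assoc (replicate (h ∸ v) false) p _)))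

-- Admissible h T: T is the token list of a path from height h, i.e. every valley
-- lies strictly below the height reached before it.
Admissible : ℕ → List Tok → Set
Admissible h []             = ⊤
Admissible h (rise ∷ T)     = Admissible (suc h) T
Admissible h (valley v ∷ T) = v < h × Admissible (suc v) T

Admissible-mono : ∀ h h′ T → h ≤ h′ → Admissible h T → Admissible h′ T
Admissible-mono h h′ []             le a         = a
Admissible-mono h h′ (rise ∷ T)     le a         = Admissible-mono (suc h) (suc h′) T (s≤s le) a
Admissible-mono h h′ (valley v ∷ T) le (v<h , a) = ≤-trans v<h le , a

Admissible-rises : ∀ h k T → Admissible (k + h) T → Admissible h (replicate k rise ++ T)
Admissible-rises h zero    T a = a
Admissible-rises h (suc k) T a = Admissible-rises (suc h) k T (subst (λ j → Admissible j T) (sym (+-suc k h)) a)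

descent-Dyck : ∀ h → DyckFrom h (replicate h false)
descent-Dyck zero    = done
descent-Dyck (suc h) = down (descent-Dyck h)

downs-Dyck : ∀ j h w → DyckFrom h w → DyckFrom (j + h) (replicate j false ++ w)
downs-Dyck zero    h w D = D
downs-Dyck (suc j) h w D = down (downs-Dyck j h w D)

path-Dyck : ∀ h T → Admissible h T → DyckFrom h (path h T)
path-Dyck h []             _         = descent-Dyck h
path-Dyck h (rise ∷ T)     a         = up (path-Dyck (suc h) T a)
path-Dyck h (valley v ∷ T) (v<h , a) =
  subst (λ k → DyckFrom k (path h (valley v ∷ T))) (m∸n+n≡m (<⇒≤ v<h))
        (downs-Dyck (h ∸ v) v _ (up (path-Dyck (suc v) T a)))

ups : Word → ℕ
ups []          = 0
ups (true ∷ w)  = suc (ups w)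
ups (false ∷ w) = ups w

ups-downs : ∀ j w → ups (replicate j false ++ w) ≡ ups w
ups-downs zero    w = refl
ups-downs (suc j) w = ups-downs j w

-- Each token is one up step.
ups-path : ∀ h T → ups (path h T) ≡ length T
ups-path h []             = trans (cong ups (sym (++-identityʳ (replicate h false)))) (ups-downs h [])
ups-path h (rise ∷ T)     = cong suc (ups-path (suc h) T)
ups-path h (valley v ∷ T) = trans (ups-downs (h ∸ v) _) (cong suc (ups-path (suc v) T))

length-Dyck : ∀ {h w} → DyckFrom h w → length w ≡ ups w + (ups w + h)
length-Dyck done = refl
length-Dyck (up {h} {w} D) = cong suc (trans (length-Dyck D) (cong (ups w +_) (+-suc (ups w) h)))
length-Dyck (down {h} {w} D) = trans (cong suc (length-Dyck D)) (sym (begin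
  ups w + (ups w + suc h) ≡⟨ cong (ups w +_) (+-suc (ups w) h) ⟩
  ups w + suc (ups w + h) ≡⟨ +-suc (ups w) (ups w + h) ⟩
  suc (ups w + (ups w + h)) ∎))

tokens-downs : ∀ b h j w → tokens b h (replicate (suc j) false ++ w) ≡ tokens false (h ∸ suc j) w
tokens-downs true  h zero    w = refl
tokens-downs false h zero    w = refl
tokens-downs b     h (suc j) w = begin
  tokens b h (false ∷ replicate (suc j) false ++ w) ≡⟨ down-step b ⟩
  tokens false (h ∸ 1) (replicate (suc j) false ++ w) ≡⟨ tokens-downs false (h ∸ 1) j w ⟩
  tokens false (h ∸ 1 ∸ suc j) w                    ≡⟨ cong (λ k → tokens false k w) (∸-+-assoc h 1 (suc j)) ⟩
  tokens false (h ∸ suc (suc j)) w                  ∎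
  where
  down-step : ∀ b → tokens b h (false ∷ replicate (suc j) false ++ w) ≡ tokens false (h ∸ 1) (replicate (suc j) false ++ w)
  down-step true  = refl
  down-step false = refl

tokens-descent : ∀ b h j → tokens b h (replicate j false) ≡ []
tokens-descent b     h zero    = refl
tokens-descent true  h (suc j) = tokens-descent false (h ∸ 1) j
tokens-descent false h (suc j) = tokens-descent false (h ∸ 1) j

upToken : Bool → ℕ → Tok
upToken true  h = rise
upToken false h = valley h

tokens-up : ∀ b h w → tokens b h (true ∷ w) ≡ upToken b h ∷ tokens true (suc h) w
tokens-up true  h w = refl
tokens-up false h w = refl

tokens-valley : ∀ {h v} W → v < h → tokens true h (replicate (h ∸ v) false ++ true ∷ W) ≡ valley v ∷ tokens true (suc v) W
tokens-valley {suc h} {v} W (s≤s v≤h) = begin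
  tokens true (suc h) (replicate (suc h ∸ v) false ++ true ∷ W)
    ≡⟨ cong (λ k → tokens true (suc h) (replicate k false ++ true ∷ W)) (+-∸-assoc 1 v≤h) ⟩
  tokens true (suc h) (replicate (suc (h ∸ v)) false ++ true ∷ W)
    ≡⟨ tokens-downs true (suc h) (h ∸ v) (true ∷ W) ⟩
  tokens false (h ∸ (h ∸ v)) (true ∷ W)
    ≡⟨ cong (λ k → tokens false k (true ∷ W)) (m∸[m∸n]≡n v≤h) ⟩
  valley v ∷ tokens true (suc v) W ∎

tokens-path : ∀ h T → Admissible h T → tokens true h (path h T) ≡ T
tokens-path h []             _         = tokens-descent true h h
tokens-path h (rise ∷ T)     a         = cong (rise ∷_) (tokens-path (suc h) T a)
tokens-path h (valley v ∷ T) (v<h , a) = trans (tokens-valley (path (suc v) T) v<h) (cong (valley v ∷_) (tokens-path (suc v) T a))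

path-tokens : ∀ {h w} → DyckFrom h w → w ≡ path h (tokens true h w)
downs-path-tokens : ∀ {h w} → DyckFrom h w → ∀ j → replicate j false ++ w ≡ path (j + h) (tokens false h w)
path-tokens done     = refl
path-tokens (up D)   = cong (true ∷_) (path-tokens D)
path-tokens (down D) = downs-path-tokens D 1
downs-path-tokens done j = trans (++-identityʳ (replicate j false)) (cong (λ k → replicate k false) (sym (+-identityʳ j)))
downs-path-tokens (up {h} {w} D) j = begin
  replicate j false ++ true ∷ w
    ≡⟨ cong (λ k → replicate k false ++ true ∷ w) (sym (m+n∸n≡m j h)) ⟩
  replicate (j + h ∸ h) false ++ true ∷ w
    ≡⟨ cong (λ z → replicate (j + h ∸ h) false ++ true ∷ z) (path-tokens D) ⟩
  replicate (j + h ∸ h) false ++ true ∷ path (suc h) (tokens true (suc h) w) ∎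
downs-path-tokens (down {h} {w} D) j = begin
  replicate j false ++ false ∷ w              ≡⟨ replicate-snoc j false w ⟩
  replicate (suc j) false ++ w                ≡⟨ downs-path-tokens D (suc j) ⟩
  path (suc j + h) (tokens false h w)         ≡⟨ cong (λ k → path k (tokens false h w)) (sym (+-suc j h)) ⟩
  path (j + suc h) (tokens false h w)         ∎

lastLetter : Bool → Word → Bool
lastLetter b []      = b
lastLetter b (c ∷ w) = lastLetter c w

heightAfter : ℕ → Word → ℕ
heightAfter h []          = h
heightAfter h (true ∷ w)  = heightAfter (suc h) w
heightAfter h (false ∷ w) = heightAfter (h ∸ 1) w

tokens-++ : ∀ b h p q → tokens b h (p ++ q) ≡ tokens b h p ++ tokens (lastLetter b p) (heightAfter h p) q
tokens-++ b     h []          q = refl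
tokens-++ true  h (true ∷ p)  q = cong (rise ∷_) (tokens-++ true (suc h) p q)
tokens-++ false h (true ∷ p)  q = cong (valley h ∷_) (tokens-++ true (suc h) p q)
tokens-++ true  h (false ∷ p) q = tokens-++ false (h ∸ 1) p q
tokens-++ false h (false ∷ p) q = tokens-++ false (h ∸ 1) p q

shift : ℕ → List Tok → List Tok
shift k []             = []
shift k (rise ∷ T)     = rise ∷ shift k T
shift k (valley v ∷ T) = valley (k + v) ∷ shift k T

tokens-lift : ∀ {j w} → DyckFrom j w → ∀ k b → tokens b (k + j) w ≡ shift k (tokens b j w)
tokens-lift done k b = refl
tokens-lift (up {j} {w} D) k true =
  cong (rise ∷_) (trans (cong (λ i → tokens true i w) (sym (+-suc k j))) (tokens-lift D k true))
tokens-lift (up {j} {w} D) k false =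
  cong (valley (k + j) ∷_) (trans (cong (λ i → tokens true i w) (sym (+-suc k j))) (tokens-lift D k true))
tokens-lift (down {j} {w} D) k true  = trans (cong (λ i → tokens false (i ∸ 1) w) (+-suc k j)) (tokens-lift D k false)
tokens-lift (down {j} {w} D) k false = trans (cong (λ i → tokens false (i ∸ 1) w) (+-suc k j)) (tokens-lift D k false)

heightAfter-Dyck : ∀ {j w} → DyckFrom j w → ∀ k → heightAfter (k + j) w ≡ k
heightAfter-Dyck done k = +-identityʳ k
heightAfter-Dyck (up {j} {w} D) k   = trans (cong (λ i → heightAfter i w) (sym (+-suc k j))) (heightAfter-Dyck D k)
heightAfter-Dyck (down {j} {w} D) k = trans (cong (λ i → heightAfter (i ∸ 1) w) (+-suc k j)) (heightAfter-Dyck D k)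

lastLetter-Dyck : ∀ {j w} → DyckFrom (suc j) w → ∀ b → lastLetter b w ≡ false
lastLetter-Dyck (up D)          b = lastLetter-Dyck D true
lastLetter-Dyck (down done)     b = refl
lastLetter-Dyck (down (up D))   b = lastLetter-Dyck D true
lastLetter-Dyck (down (down D)) b = lastLetter-Dyck (down D) false

tokens-factor : ∀ b h y s → DyckFrom 1 y →
  tokens b h (true ∷ y ++ s) ≡ upToken b h ∷ shift h (tokens true 1 y) ++ tokens false h s
tokens-factor b h y s D = trans (tokens-up b h (y ++ s)) (cong (upToken b h ∷_) (begin
  tokens true (suc h) (y ++ s)
    ≡⟨ tokens-++ true (suc h) y s ⟩
  tokens true (suc h) y ++ tokens (lastLetter true y) (heightAfter (suc h) y) s
    ≡⟨ cong (λ i → tokens true i y ++ tokens (lastLetter true y) (heightAfter i y) s) (+-comm 1 h) ⟩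
  tokens true (h + 1) y ++ tokens (lastLetter true y) (heightAfter (h + 1) y) s
    ≡⟨ cong₂ _++_ (tokens-lift D h true)
                  (cong₂ (λ b′ i → tokens b′ i s) (lastLetter-Dyck D true) (heightAfter-Dyck D h)) ⟩
  shift h (tokens true 1 y) ++ tokens false h s ∎))

tokens-after-downs : ∀ b h j y s → DyckFrom 1 y →
  tokens b h (replicate (suc j) false ++ true ∷ y ++ s)
    ≡ valley (h ∸ suc j) ∷ shift (h ∸ suc j) (tokens true 1 y) ++ tokens false (h ∸ suc j) s
tokens-after-downs b h j y s D = trans (tokens-downs b h j (true ∷ y ++ s)) (tokens-factor false (h ∸ suc j) y s D)

prefixTokens : Word → List Tok
prefixTokens p = tokens true 0 p ++ upToken (lastLetter true p) (heightAfter 0 p) ∷ []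

tokens-prefix : ∀ p Z → tokens true 0 (p ++ true ∷ Z) ≡ prefixTokens p ++ tokens true (suc (heightAfter 0 p)) Z
tokens-prefix p Z = begin
  tokens true 0 (p ++ true ∷ Z)
    ≡⟨ tokens-++ true 0 p (true ∷ Z) ⟩
  tokens true 0 p ++ tokens (lastLetter true p) (heightAfter 0 p) (true ∷ Z)
    ≡⟨ cong (tokens true 0 p ++_) (tokens-up (lastLetter true p) (heightAfter 0 p) Z) ⟩
  tokens true 0 p ++ upToken (lastLetter true p) (heightAfter 0 p) ∷ tokens true (suc (heightAfter 0 p)) Z
    ≡⟨ sym (++-assoc (tokens true 0 p) (upToken (lastLetter true p) (heightAfter 0 p) ∷ []) _) ⟩
  prefixTokens p ++ tokens true (suc (heightAfter 0 p)) Z ∎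

valleyHeights : List Tok → List ℕ
valleyHeights []             = []
valleyHeights (rise ∷ T)     = valleyHeights T
valleyHeights (valley h ∷ T) = h ∷ valleyHeights T

valleyHeights-++ : ∀ A B → valleyHeights (A ++ B) ≡ valleyHeights A ++ valleyHeights B
valleyHeights-++ []             B = refl
valleyHeights-++ (rise ∷ A)     B = valleyHeights-++ A B
valleyHeights-++ (valley h ∷ A) B = cong (h ∷_) (valleyHeights-++ A B)

valleyHeights-rises : ∀ k T → valleyHeights (replicate k rise ++ T) ≡ valleyHeights T
valleyHeights-rises zero    T = refl
valleyHeights-rises (suc k) T = valleyHeights-rises k T

valleyHeights-shift : ∀ k R S → valleyHeights (shift k R ++ S) ≡ map (k +_) (valleyHeights R) ++ valleyHeights S
valleyHeights-shift k []             S = refl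
valleyHeights-shift k (rise ∷ R)     S = valleyHeights-shift k R S
valleyHeights-shift k (valley v ∷ R) S = cong ((k + v) ∷_) (valleyHeights-shift k R S)

isValley : Tok → Bool
isValley rise       = false
isValley (valley _) = true

lastIsValley : Bool → List Tok → Bool
lastIsValley b []      = b
lastIsValley b (t ∷ T) = lastIsValley (isValley t) T

lastIsValley-++ : ∀ b A B → lastIsValley b (A ++ B) ≡ lastIsValley (lastIsValley b A) B
lastIsValley-++ b []      B = refl
lastIsValley-++ b (t ∷ A) B = lastIsValley-++ (isValley t) A B

lastIsValley-shift : ∀ b k R S → lastIsValley b (shift k R ++ S) ≡ lastIsValley b (R ++ S)
lastIsValley-shift b k []             S = refl
lastIsValley-shift b k (rise ∷ R)     S = lastIsValley-shift false k R S
lastIsValley-shift b k (valley v ∷ R) S = lastIsValley-shift true k R S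

-- The default value only matters for the empty list.
lastIsValley-weaken : ∀ b T → IsTrue (lastIsValley false T) → IsTrue (lastIsValley b T)
lastIsValley-weaken b (t ∷ T) e = e

lastIsValley-valley-free : ∀ R S → valleyHeights R ≡ [] → lastIsValley false (R ++ S) ≡ lastIsValley false S
lastIsValley-valley-free []             S _  = refl
lastIsValley-valley-free (rise ∷ R)     S vf = lastIsValley-valley-free R S vf
lastIsValley-valley-free (valley v ∷ R) S ()

Descending : ℕ → List ℕ → Set
Descending m []      = ⊤
Descending m (x ∷ l) = x ≤ m × Descending x l

lastOr : ℕ → List ℕ → ℕ
lastOr m []      = m
lastOr m (x ∷ l) = lastOr x l

lastOr-≤ : ∀ m l → Descending m l → lastOr m l ≤ m
lastOr-≤ m []      _          = ≤-refl
lastOr-≤ m (x ∷ l) (x≤m , dl) = ≤-trans (lastOr-≤ x l dl) x≤m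

Descending-++⁻ : ∀ m A B → Descending m (A ++ B) → Descending m A × Descending (lastOr m A) B
Descending-++⁻ m []      B d          = _ , d
Descending-++⁻ m (x ∷ A) B (x≤m , d) with Descending-++⁻ x A B d
... | dA , dB = (x≤m , dA) , dB

Descending-++⁺ : ∀ m A B → Descending m A → Descending (lastOr m A) B → Descending m (A ++ B)
Descending-++⁺ m []      B _          dB = dB
Descending-++⁺ m (x ∷ A) B (x≤m , dA) dB = x≤m , Descending-++⁺ x A B dA dB

Descending-weaken : ∀ c m l → c ≤ m → Descending c l → Descending m l
Descending-weaken c m []      c≤m _          = _
Descending-weaken c m (x ∷ l) c≤m (x≤c , dl) = ≤-trans x≤c c≤m , dl

Descending⇒bounded : ∀ m l → Descending m l → All (_≤ m) l
Descending⇒bounded m []      _          = []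
Descending⇒bounded m (x ∷ l) (x≤m , dl) = x≤m ∷ All.map (λ y≤x → ≤-trans y≤x x≤m) (Descending⇒bounded x l dl)

Descending-lifted⁻ : ∀ k r s → Descending k (map (k +_) r ++ s) → All (_≡ 0) r × Descending k s
Descending-lifted⁻ k []      s d          = [] , d
Descending-lifted⁻ k (x ∷ r) s (k+x≤k , d)
  with n≤0⇒n≡0 (+-cancelˡ-≤ k x 0 (subst (k + x ≤_) (sym (+-identityʳ k)) k+x≤k))
... | refl with Descending-lifted⁻ k r s (subst (λ i → Descending i (map (k +_) r ++ s)) (+-identityʳ k) d)
... | zeros , ds = refl ∷ zeros , ds

Descending-lifted⁺ : ∀ k r s → All (_≡ 0) r → Descending k s → Descending k (map (k +_) r ++ s)
Descending-lifted⁺ k []      s []          ds = ds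
Descending-lifted⁺ k (x ∷ r) s (refl ∷ zs) ds =
  subst (λ i → i ≤ k × Descending i (map (k +_) r ++ s)) (sym (+-identityʳ k)) (≤-refl , Descending-lifted⁺ k r s zs ds)

Good : List Tok → Set
Good T = Descending 1 (valleyHeights T) × IsTrue (lastIsValley false T)

-- Goodness of the tail X of a good list whose earlier valleys end at height M.
TailGood : ℕ → List Tok → Set
TailGood M X = Descending M (valleyHeights X) × IsTrue (lastIsValley false X)

-- Goodness of P ++ X depends on the tail X only through TailGood for the bound
-- left by P, so the tail may be replaced by any tail that is at least as good.
good-replace-tail : ∀ P {t X t′ X′} → (∀ M → M ≤ 1 → TailGood M (t′ ∷ X′) → TailGood M (t ∷ X)) →
  Good (P ++ t′ ∷ X′) → Good (P ++ t ∷ X)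
good-replace-tail P {t} {X} {t′} {X′} tail-step (d , e)
  with Descending-++⁻ 1 (valleyHeights P) (valleyHeights (t′ ∷ X′)) (subst (Descending 1) (valleyHeights-++ P (t′ ∷ X′)) d)
... | dP , dX′ with tail-step (lastOr 1 (valleyHeights P)) (lastOr-≤ 1 _ dP)
                      (dX′ , subst IsTrue (lastIsValley-++ false P (t′ ∷ X′)) e)
... | dX , eX = subst (Descending 1) (sym (valleyHeights-++ P (t ∷ X))) (Descending-++⁺ 1 _ _ dP dX) ,
                subst IsTrue (sym (lastIsValley-++ false P (t ∷ X))) eX

-- SuffixAt c S: S is empty or starts with a valley at height c; these are the
-- tokens of a suffix that is empty or starts with an up step, entered after a
-- down step to height c.
SuffixAt : ℕ → List Tok → Set
SuffixAt c S = S ≡ [] ⊎ ∃ λ S′ → S ≡ valley c ∷ S′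

suffixAt-tokens : ∀ c s → EmptyOrStartsUp s → SuffixAt c (tokens false c s)
suffixAt-tokens c .[]         (inj₁ refl)      = inj₁ refl
suffixAt-tokens c .(true ∷ s) (inj₂ (s , refl)) = inj₂ (_ , refl)

Descending-suffix : ∀ c c′ S → SuffixAt c S → Descending c′ (valleyHeights S) → Descending c (valleyHeights S)
Descending-suffix c c′ .[]            (inj₁ refl)       _         = _
Descending-suffix c c′ .(valley c ∷ S) (inj₂ (S , refl)) (_ , dS) = ≤-refl , dS

-- In a cover the moved factor has tokens R and is followed by S.  If the upper
-- path enters it by a valley c′ and the lower one by a valley c ≤ c′, a good
-- upper tail forces all valleys of R to its base, so the lower tail is good too.
lowered-valley : ∀ M c c′ R S → c ≤ c′ → SuffixAt c S →
  TailGood M (valley c′ ∷ shift c′ R ++ S) → TailGood M (valley c ∷ shift c R ++ S)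
lowered-valley M c c′ R S c≤c′ sf ((c′≤M , d) , e)
  with Descending-lifted⁻ c′ (valleyHeights R) (valleyHeights S) (subst (Descending c′) (valleyHeights-shift c′ R S) d)
... | zeros , dS =
  (≤-trans c≤c′ c′≤M , subst (Descending c) (sym (valleyHeights-shift c R S))
                         (Descending-lifted⁺ c _ _ zeros (Descending-suffix c c′ S sf dS))) ,
  subst IsTrue (trans (lastIsValley-shift true c′ R S) (sym (lastIsValley-shift true c R S))) e

-- The same when the upper path enters the factor by a rise at height H+1 and
-- the lower one by a valley c ≤ H: since heights are at most 1, either R has
-- valleys and then H = c = 0 with all of them at the base, or S starts with c.
risen-heights : ∀ M H c r S → M ≤ 1 → c ≤ H → SuffixAt c S →
  Descending M (map (suc H +_) r ++ valleyHeights S) → (r ≡ [] → S ≢ []) →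
  Descending M (c ∷ map (c +_) r ++ valleyHeights S)
risen-heights M H c [] .[] M≤1 c≤H (inj₁ refl) d nonempty = ⊥-elim (nonempty refl refl)
risen-heights M H c [] .(valley c ∷ S) M≤1 c≤H (inj₂ (S , refl)) (c≤M , dS) nonempty = c≤M , ≤-refl , dS
risen-heights M (suc H) c (x ∷ r) S M≤1 c≤H sf (le , _) nonempty with ≤-trans le M≤1
... | s≤s ()
risen-heights M zero c (suc x ∷ r) S M≤1 c≤H sf (le , _) nonempty with ≤-trans le M≤1
... | s≤s ()
risen-heights M zero zero (zero ∷ r) S M≤1 z≤n sf (_ , d) nonempty with Descending-lifted⁻ 1 r (valleyHeights S) d
... | zeros , dS = z≤n , z≤n , Descending-lifted⁺ 0 r _ zeros (Descending-suffix 0 1 S sf dS)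

risen-valley : ∀ M H c R S → M ≤ 1 → c ≤ H → SuffixAt c S →
  TailGood M (rise ∷ shift (suc H) R ++ S) → TailGood M (valley c ∷ shift c R ++ S)
risen-valley M H c R S M≤1 c≤H sf (d , e) =
  subst (Descending M) (cong (c ∷_) (sym (valleyHeights-shift c R S)))
    (risen-heights M H c (valleyHeights R) S M≤1 c≤H sf (subst (Descending M) (valleyHeights-shift (suc H) R S) d) nonempty) ,
  subst IsTrue (sym (lastIsValley-shift true c R S)) (lastIsValley-weaken true (R ++ S) eRS)
  where
  eRS : IsTrue (lastIsValley false (R ++ S))
  eRS = subst IsTrue (lastIsValley-shift false (suc H) R S) e
  nonempty : valleyHeights R ≡ [] → S ≢ []
  nonempty vf refl = subst IsTrue (lastIsValley-valley-free R [] vf) eRS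

-- A cover moving the factor 1y (y a Dyck path from height 1) across down
-- steps: below it are p 1 0^(m+1) 1y s, with H the height after p.
module MovedFactor (p y s : Word) (m : ℕ) (Dy : DyckFrom 1 y) (eos : EmptyOrStartsUp s) where
  H : ℕ
  H = heightAfter 0 p
  P : List Tok
  P = prefixTokens p
  R : List Tok
  R = tokens true 1 y
  c : ℕ
  c = suc H ∸ suc m
  S : List Tok
  S = tokens false c s

  tokens-lower : tokens true 0 (p ++ true ∷ (replicate (suc m) false ++ (true ∷ y) ++ s)) ≡ P ++ valley c ∷ shift c R ++ S
  tokens-lower = trans (tokens-prefix p _) (cong (P ++_) (tokens-after-downs true (suc H) m y s Dy))

  -- The factor is moved up to the preceding up step: its valley replaces a rise.
  good-jump : Good (tokens true 0 (p ++ true ∷ ((true ∷ y) ++ replicate (suc m) false ++ s))) →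
              Good (tokens true 0 (p ++ true ∷ (replicate (suc m) false ++ (true ∷ y) ++ s)))
  good-jump g = subst Good (sym tokens-lower)
    (good-replace-tail P (λ M M≤1 → risen-valley M H c R S M≤1 (m∸n≤m H m) (suffixAt-tokens c s eos))
                         (subst Good tokens-upper g))
    where
    tokens-upper : tokens true 0 (p ++ true ∷ ((true ∷ y) ++ replicate (suc m) false ++ s)) ≡ P ++ rise ∷ shift (suc H) R ++ S
    tokens-upper = trans (tokens-prefix p _) (cong (P ++_) (trans (tokens-factor true (suc H) y _ Dy)
                     (cong (λ X → rise ∷ shift (suc H) R ++ X) (tokens-downs false (suc H) m s))))

  -- The factor is moved up by a+1 < m+1 steps: its valley is raised to c′ ≥ c.
  good-slide : ∀ a b → suc a + suc b ≡ suc m →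
    Good (tokens true 0 (p ++ true ∷ (replicate (suc a) false ++ (true ∷ y) ++ replicate (suc b) false ++ s))) →
    Good (tokens true 0 (p ++ true ∷ (replicate (suc m) false ++ (true ∷ y) ++ s)))
  good-slide a b ab g = subst Good (sym tokens-lower)
    (good-replace-tail P (λ M _ → lowered-valley M c c′ R S c≤c′ (suffixAt-tokens c s eos)) (subst Good tokens-upper g))
    where
    c′ : ℕ
    c′ = suc H ∸ suc a
    c≤c′ : c ≤ c′
    c≤c′ = ∸-monoʳ-≤ (suc H) (≤-trans (m≤m+n (suc a) (suc b)) (≤-reflexive ab))
    c′-c : c′ ∸ suc b ≡ c
    c′-c = trans (∸-+-assoc (suc H) (suc a) (suc b)) (cong (suc H ∸_) ab)
    tokens-upper : tokens true 0 (p ++ true ∷ (replicate (suc a) false ++ (true ∷ y) ++ replicate (suc b) false ++ s))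
                   ≡ P ++ valley c′ ∷ shift c′ R ++ S
    tokens-upper = trans (tokens-prefix p _) (cong (P ++_) (trans (tokens-after-downs true (suc H) a y _ Dy)
                     (cong (λ X → valley c′ ∷ shift c′ R ++ X)
                           (trans (tokens-downs false c′ b s) (cong (λ i → tokens false i s) c′-c)))))

open MovedFactor using (good-jump; good-slide)

good-cover : ∀ {d d′} → DexCover d d′ → Good (tokens true 0 d′) → Good (tokens true 0 d)
good-cover (cover p [] s m α β _ _ _ αβ _ refl refl) = subst (λ w → Good (tokens true 0 w))
  (cong (λ z → p ++ true ∷ z) (trans (replicate-++ α β false s) (cong (λ k → replicate k false ++ s) αβ)))
good-cover (cover p (false ∷ y) s m α β _ (() , _) _ _ _ _ _)
good-cover (cover p (true ∷ y) s zero α β () _ _ _ _ _ _)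
good-cover (cover p (true ∷ y) s (suc m) zero β _ (up Dy , _) eos refl _ refl refl) = good-jump p y s m Dy eos
good-cover (cover p (true ∷ y) s (suc m) (suc α) zero _ _ _ _ () refl refl)
good-cover (cover p (true ∷ y) s (suc m) (suc α) (suc β) _ (up Dy , _) eos αβ _ refl refl) = good-slide p y s m Dy eos α β αβ

good-below : ∀ {d d′} → d ≼Dex d′ → Good (tokens true 0 d′) → Good (tokens true 0 d)
good-below ε         g = g
good-below (c ◅ d≼d′) g = good-cover c (good-below d≼d′ g)

StartsUpUp : Word → Set
StartsUpUp d = ∃ λ w → d ≡ true ∷ true ∷ w

startsUpUp-cover : ∀ {d d′} → DexCover d d′ → StartsUpUp d → StartsUpUp d′
startsUpUp-cover (cover [] _ _ zero _ _ () _ _ _ _ refl refl) _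
startsUpUp-cover (cover [] _ _ (suc m) _ _ _ _ _ _ _ refl refl) (_ , ())
startsUpUp-cover (cover (a ∷ []) _ _ _ _ _ _ _ _ _ _ refl refl) (_ , refl) = _ , refl
startsUpUp-cover (cover (a ∷ b ∷ p) _ _ _ _ _ _ _ _ _ _ refl refl) (_ , refl) = _ , refl

startsUpUp-above : ∀ {d d′} → d ≼Dex d′ → StartsUpUp d → StartsUpUp d′
startsUpUp-above ε         st = st
startsUpUp-above (c ◅ d≼d′) st = startsUpUp-above d≼d′ (startsUpUp-cover c st)

blocks : ℕ → List ℕ → List Tok
blocks c []       = []
blocks c (k ∷ ks) = replicate k rise ++ valley c ∷ blocks c ks

size : List ℕ → ℕ
size []       = 0
size (k ∷ ks) = suc (k + size ks)

size-++ : ∀ ks ls → size (ks ++ ls) ≡ size ks + size ls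
size-++ []       ls = refl
size-++ (k ∷ ks) ls = cong suc (trans (cong (k +_) (size-++ ks ls)) (sym (+-assoc k (size ks) (size ls))))

length-blocks : ∀ c ks → length (blocks c ks) ≡ size ks
length-blocks c []       = refl
length-blocks c (k ∷ ks) = begin
  length (replicate k rise ++ valley c ∷ blocks c ks)
    ≡⟨ length-++ (replicate k rise) ⟩
  length (replicate k rise) + suc (length (blocks c ks))
    ≡⟨ cong₂ (λ i j → i + suc j) (length-replicate k) (length-blocks c ks) ⟩
  k + suc (size ks)
    ≡⟨ +-suc k (size ks) ⟩
  suc (k + size ks) ∎

blocks-snoc : ∀ c ks l → blocks c (ks ++ l ∷ []) ≡ blocks c ks ++ replicate l rise ++ valley c ∷ []
blocks-snoc c []       l = refl
blocks-snoc c (k ∷ ks) l = trans (cong (λ X → replicate k rise ++ valley c ∷ X) (blocks-snoc c ks l))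
  (sym (++-assoc (replicate k rise) (valley c ∷ blocks c ks) _))

Descending-blocks : ∀ c m ks Y → c ≤ m → Descending c (valleyHeights Y) → Descending m (valleyHeights (blocks c ks ++ Y))
Descending-blocks c m []       Y c≤m dY = Descending-weaken c m _ c≤m dY
Descending-blocks c m (k ∷ ks) Y c≤m dY =
  subst (Descending m) (sym (trans (cong valleyHeights (++-assoc (replicate k rise) (valley c ∷ blocks c ks) Y))
                                   (valleyHeights-rises k _)))
        (c≤m , Descending-blocks c c ks Y ≤-refl dY)

lastIsValley-blocks : ∀ b c k ks → lastIsValley b (blocks c (k ∷ ks)) ≡ true
lastIsValley-blocks b c k []        = lastIsValley-++ b (replicate k rise) (valley c ∷ [])
lastIsValley-blocks b c k (k′ ∷ ks) =
  trans (lastIsValley-++ b (replicate k rise) (valley c ∷ blocks c (k′ ∷ ks))) (lastIsValley-blocks true c k′ ks)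

good-blocks : ∀ ks ls → (ks ≡ [] → ls ≡ [] → ⊥) → Good (blocks 1 ks ++ blocks 0 ls)
good-blocks ks ls nonempty =
  Descending-blocks 1 1 ks (blocks 0 ls) ≤-refl
    (subst (λ X → Descending 1 (valleyHeights X)) (++-identityʳ (blocks 0 ls)) (Descending-blocks 0 1 ls [] z≤n _)) ,
  subst IsTrue (sym (trans (lastIsValley-++ false (blocks 1 ks) (blocks 0 ls)) (ends ks ls nonempty))) _
  where
  ends : ∀ ks ls → (ks ≡ [] → ls ≡ [] → ⊥) → lastIsValley (lastIsValley false (blocks 1 ks)) (blocks 0 ls) ≡ true
  ends ks       (l ∷ ls) _        = lastIsValley-blocks _ 0 l ls
  ends []       []       nonempty = ⊥-elim (nonempty refl refl)
  ends (k ∷ ks) []       _        = lastIsValley-blocks false 1 k ks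

Admissible-blocks : ∀ c ks Y h → c < h → Admissible (suc c) Y → Admissible h (blocks c ks ++ Y)
Admissible-blocks c []       Y h c<h a = Admissible-mono (suc c) h Y c<h a
Admissible-blocks c (k ∷ ks) Y h c<h a = subst (Admissible h) (sym (++-assoc (replicate k rise) (valley c ∷ blocks c ks) Y))
  (Admissible-rises h k _ (≤-trans c<h (m≤n+m h k) , Admissible-blocks c ks Y (suc c) ≤-refl a))

admissible-blocks : ∀ ks ls → Admissible 2 (blocks 1 ks ++ blocks 0 ls)
admissible-blocks ks ls = Admissible-blocks 1 ks (blocks 0 ls) 2 ≤-refl
  (subst (Admissible 2) (++-identityʳ (blocks 0 ls)) (Admissible-blocks 0 ls [] 2 (s≤s z≤n) _))


fromTokens : List Tok → Word
fromTokens T = path 0 (rise ∷ rise ∷ T)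

top-tokens : ∀ n → topF (suc n) ≡ fromTokens (blocks 1 (n ∷ []))
top-tokens n = cong (λ z → true ∷ true ∷ z) (sym (begin
  path 2 (replicate n rise ++ valley 1 ∷ [])        ≡⟨ path-rises 2 n _ ⟩
  replicate n true ++ path (n + 2) (valley 1 ∷ [])  ≡⟨ cong (λ k → replicate n true ++ path k (valley 1 ∷ [])) (+-comm n 2) ⟩
  replicate n true ++ path (2 + n) (valley 1 ∷ [])  ∎))

good-top : ∀ n → Good (tokens true 0 (topF (suc n)))
good-top n = subst Good (sym (trans (cong (tokens true 0) (top-tokens n)) (tokens-path 0 (rise ∷ rise ∷ top) admissible)))
  (subst Good (++-identityʳ top) (good-blocks (n ∷ []) [] (λ ())))
  where
  top : List Tok
  top = blocks 1 (n ∷ [])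
  admissible : Admissible 2 top
  admissible = subst (Admissible 2) (++-identityʳ top) (admissible-blocks (n ∷ []) [])

bottom-tokens : ∀ n → botF n ≡ fromTokens (replicate n (valley 0))
bottom-tokens zero    = refl
bottom-tokens (suc n) = cong (λ z → true ∷ true ∷ false ∷ false ∷ true ∷ z) (sym (low-valleys n))
  where
  low-valleys : ∀ k → path 1 (replicate k (valley 0)) ≡ false ∷ tens k
  low-valleys zero    = refl
  low-valleys (suc k) = cong (λ z → false ∷ true ∷ z) (low-valleys k)

length-tokens : ∀ b h w → length (tokens b h w) ≡ ups w
length-tokens b     h []          = refl
length-tokens true  h (true ∷ w)  = cong suc (length-tokens true (suc h) w)
length-tokens false h (true ∷ w)  = cong suc (length-tokens true (suc h) w)
length-tokens true  h (false ∷ w) = length-tokens false (h ∸ 1) w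
length-tokens false h (false ∷ w) = length-tokens false (h ∸ 1) w

F-shape : ∀ n d → InF (suc n) d →
  ∃ λ w → d ≡ true ∷ true ∷ w × DyckFrom 2 w × Good (tokens true 2 w) × ups w ≡ suc n
F-shape n d ((dy , len) , bot≼d , d≼top) with startsUpUp-above bot≼d (_ , refl)
... | w , refl with dy
... | up (up D) = w , refl , D , good-below d≼top (good-top n) , ups-w
  where
  ups-w : ups w ≡ suc n
  ups-w = suc-injective (suc-injective (trans (*-cancelˡ-≡ _ _ 2 (trans (sym (length-Dyck dy)) len)) (+-comm (suc n) 2)))

encode-rises : ∀ j k Z → encode j (replicate k rise ++ Z) ≡ encode (k + j) Z
encode-rises j zero    Z = refl
encode-rises j (suc k) Z = trans (encode-rises (suc j) k Z) (cong (λ i → encode i Z) (+-suc k j))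

encode-length : ∀ j T → IsTrue (lastIsValley false T) → length (encode j T) ≡ j + length T
encode-length j (rise ∷ T)     e = trans (encode-length (suc j) T e) (sym (+-suc j (length T)))
encode-length j (valley h ∷ T) e = begin
  suc (length (replicate j 2 ++ encode 0 T))          ≡⟨ cong suc (length-++ (replicate j 2)) ⟩
  suc (length (replicate j 2) + length (encode 0 T))  ≡⟨ cong suc (cong₂ _+_ (length-replicate j) (rest T e)) ⟩
  suc (j + length T)                                  ≡⟨ sym (+-suc j (length T)) ⟩
  j + suc (length T)                                  ∎
  where
  rest : ∀ T → IsTrue (lastIsValley true T) → length (encode 0 T) ≡ length T
  rest []      _ = refl
  rest (t ∷ T) e = encode-length 0 (t ∷ T) e

encode-bounded : ∀ j T → All (_≤ 1) (valleyHeights T) → All (_≤ 2) (encode j T)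
encode-bounded j []             _          = []
encode-bounded j (rise ∷ T)     b          = encode-bounded (suc j) T b
encode-bounded j (valley h ∷ T) (h≤1 ∷ b) = ≤-trans h≤1 (n≤1+n 1) ∷ ++⁺ (replicate⁺ j ≤-refl) (encode-bounded 0 T b)

encode-head : ∀ j T w → All (_≤ 1) (valleyHeights T) → encode j T ≢ 2 ∷ w
encode-head j []             w _                ()
encode-head j (rise ∷ T)     w b                eq   = encode-head (suc j) T w b eq
encode-head j (valley h ∷ T) w (s≤s () ∷ _)     refl

NoZeroBeforeOne : List ℕ → Set
NoZeroBeforeOne []      = ⊤
NoZeroBeforeOne (c ∷ u) = (c ≡ 0 → All (_≢ 1) u) × NoZeroBeforeOne u

twos-NoZeroBeforeOne : ∀ j u → NoZeroBeforeOne u → NoZeroBeforeOne (replicate j 2 ++ u)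
twos-NoZeroBeforeOne zero    u n = n
twos-NoZeroBeforeOne (suc j) u n = (λ ()) , twos-NoZeroBeforeOne j u n

encode-no-1 : ∀ j T → Descending 0 (valleyHeights T) → All (_≢ 1) (encode j T)
encode-no-1 j []              _       = []
encode-no-1 j (rise ∷ T)      d       = encode-no-1 (suc j) T d
encode-no-1 j (valley .0 ∷ T) (z≤n , d) = (λ ()) ∷ ++⁺ (replicate⁺ j (λ ())) (encode-no-1 0 T d)

encode-NoZeroBeforeOne : ∀ m j T → Descending m (valleyHeights T) → NoZeroBeforeOne (encode j T)
encode-NoZeroBeforeOne m j []             _          = _
encode-NoZeroBeforeOne m j (rise ∷ T)     d          = encode-NoZeroBeforeOne m (suc j) T d
encode-NoZeroBeforeOne m j (valley h ∷ T) (_ , d) =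
  (λ { refl → ++⁺ (replicate⁺ j (λ ())) (encode-no-1 0 T d) }) ,
  twos-NoZeroBeforeOne j _ (encode-NoZeroBeforeOne h 0 T d)

lookup-All : ∀ {P : ℕ → Set} u → All P u → ∀ i → P (lookup u i)
lookup-All (x ∷ u) (px ∷ _)  fzero    = px
lookup-All (x ∷ u) (_ ∷ pu) (fsuc i) = lookup-All u pu i

All-lookup : ∀ {P : ℕ → Set} u → (∀ i → P (lookup u i)) → All P u
All-lookup []      f = []
All-lookup (x ∷ u) f = f fzero ∷ All-lookup u (f ∘ fsuc)

NoZeroBeforeOne⇒positional : ∀ u → NoZeroBeforeOne u →
  ∀ (i j : Fin (length u)) → i <ᶠ j → lookup u i ≡ 0 → lookup u j ≡ 1 → ⊥
NoZeroBeforeOne⇒positional (c ∷ u) (zero-first , _) fzero    (fsuc j) _        c≡0 =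
  lookup-All u (zero-first c≡0) j
NoZeroBeforeOne⇒positional (c ∷ u) (_ , n)          (fsuc i) (fsuc j) (s≤s i<j) =
  NoZeroBeforeOne⇒positional u n i j i<j

positional⇒NoZeroBeforeOne : ∀ u → (∀ (i j : Fin (length u)) → i <ᶠ j → lookup u i ≡ 0 → lookup u j ≡ 1 → ⊥) →
  NoZeroBeforeOne u
positional⇒NoZeroBeforeOne []      f = _
positional⇒NoZeroBeforeOne (c ∷ u) f =
  (λ c≡0 → All-lookup u (λ j u₁≡1 → f fzero (fsuc j) (s≤s z≤n) c≡0 u₁≡1)) ,
  positional⇒NoZeroBeforeOne u (λ i j i<j → f (fsuc i) (fsuc j) (s≤s i<j))

encode-in-Tr : ∀ n T → Good T → length T ≡ n → InTr n (encode 0 T)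
encode-in-Tr n T (d , e) len =
  trans (encode-length 0 T e) len ,
  encode-bounded 0 T bounded ,
  (λ w → encode-head 0 T w bounded) ,
  NoZeroBeforeOne⇒positional (encode 0 T) (encode-NoZeroBeforeOne 1 0 T d)
  where
  bounded : All (_≤ 1) (valleyHeights T)
  bounded = Descending⇒bounded 1 _ d

ρ-into-Tr : ∀ n d → InF (suc n) d → InTr (suc n) (ρ d)
ρ-into-Tr n d inF with F-shape n d inF
... | w , refl , _ , g , ups-w =
  subst (InTr (suc n)) (sym (go-encode true 2 0 w)) (encode-in-Tr (suc n) (tokens true 2 w) g (trans (length-tokens true 2 w) ups-w))

-- decodeFrom c k r reads the rest r of an output of ρ that follows a letter c
-- emitted by a valley preceded by k rises; decode inverts encode on good lists.
decodeFrom : ℕ → ℕ → List ℕ → List Tok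
decodeFrom c k []      = replicate k rise ++ valley c ∷ []
decodeFrom c k (2 ∷ r) = decodeFrom c (suc k) r
decodeFrom c k (x ∷ r) = replicate k rise ++ valley c ∷ decodeFrom x 0 r

decode : List ℕ → List Tok
decode []      = []
decode (c ∷ r) = decodeFrom c 0 r

decodeFrom-twos : ∀ c k j r → decodeFrom c k (replicate j 2 ++ r) ≡ decodeFrom c (k + j) r
decodeFrom-twos c k zero    r = cong (λ i → decodeFrom c i r) (sym (+-identityʳ k))
decodeFrom-twos c k (suc j) r = trans (decodeFrom-twos c (suc k) j r) (cong (λ i → decodeFrom c i r) (sym (+-suc k j)))

decodeFrom-valley : ∀ c k x r → x ≢ 2 → decodeFrom c k (x ∷ r) ≡ replicate k rise ++ valley c ∷ decodeFrom x 0 r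
decodeFrom-valley c k zero                r _   = refl
decodeFrom-valley c k (suc zero)          r _   = refl
decodeFrom-valley c k (suc (suc zero))    r x≢2 = ⊥-elim (x≢2 refl)
decodeFrom-valley c k (suc (suc (suc x))) r _   = refl

-- The rises pending before the end of the output must be closed by a valley.
decodeFrom-encode : ∀ c k j T → All (_≢ 2) (valleyHeights T) → IsTrue (lastIsValley true (replicate j rise ++ T)) →
  decodeFrom c k (encode j T) ≡ replicate k rise ++ valley c ∷ replicate j rise ++ T
decodeFrom-encode c k zero    [] _ _ = refl
decodeFrom-encode c k (suc j) [] _ e = ⊥-elim (subst IsTrue (rises-end j) e)
  where
  rises-end : ∀ j → lastIsValley false (replicate j rise ++ []) ≡ false
  rises-end zero    = refl
  rises-end (suc j) = rises-end j
decodeFrom-encode c k j (rise ∷ T) no2 e =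
  trans (decodeFrom-encode c k (suc j) T no2 (subst (IsTrue ∘ lastIsValley true) (replicate-snoc j rise T) e))
        (cong (λ X → replicate k rise ++ valley c ∷ X) (sym (replicate-snoc j rise T)))
decodeFrom-encode c k j (valley h ∷ T) (h≢2 ∷ no2) e = begin
  decodeFrom c k (h ∷ replicate j 2 ++ encode 0 T)
    ≡⟨ decodeFrom-valley c k h _ h≢2 ⟩
  replicate k rise ++ valley c ∷ decodeFrom h 0 (replicate j 2 ++ encode 0 T)
    ≡⟨ cong (λ X → replicate k rise ++ valley c ∷ X) (trans (decodeFrom-twos h 0 j _) (decodeFrom-encode h j 0 T no2 e′)) ⟩
  replicate k rise ++ valley c ∷ replicate j rise ++ valley h ∷ T ∎
  where
  e′ : IsTrue (lastIsValley true T)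
  e′ = subst IsTrue (lastIsValley-++ true (replicate j rise) (valley h ∷ T)) e

decode-encode : ∀ j T → All (_≢ 2) (valleyHeights T) → IsTrue (lastIsValley false T) →
  decode (encode j T) ≡ replicate j rise ++ T
decode-encode j (rise ∷ T)     no2       e = trans (decode-encode (suc j) T no2 e) (sym (replicate-snoc j rise T))
decode-encode j (valley h ∷ T) (_ ∷ no2) e = trans (decodeFrom-twos h 0 j _) (decodeFrom-encode h j 0 T no2 e)

≤1⇒≢2 : ∀ {h} → h ≤ 1 → h ≢ 2
≤1⇒≢2 (s≤s ()) refl

F-from-ρ : ∀ n d → InF (suc n) d → d ≡ true ∷ true ∷ path 2 (decode (ρ d))
F-from-ρ n d inF with F-shape n d inF
... | w , refl , D , (desc , e) , _ = cong (λ z → true ∷ true ∷ z) (begin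
  w                                             ≡⟨ path-tokens D ⟩
  path 2 (tokens true 2 w)                      ≡⟨ cong (path 2) (sym (decode-encode 0 (tokens true 2 w) no2 e)) ⟩
  path 2 (decode (encode 0 (tokens true 2 w)))  ≡⟨ cong (path 2 ∘ decode) (sym (go-encode true 2 0 w)) ⟩
  path 2 (decode (ρ (true ∷ true ∷ w)))         ∎)
  where
  no2 : All (_≢ 2) (valleyHeights (tokens true 2 w))
  no2 = All.map ≤1⇒≢2 (Descending⇒bounded 1 _ desc)

ρ-injective : ∀ n d d′ → InF (suc n) d → InF (suc n) d′ → ρ d ≡ ρ d′ → d ≡ d′
ρ-injective n d d′ inF inF′ eq = begin
  d                                        ≡⟨ F-from-ρ n d inF ⟩
  true ∷ true ∷ path 2 (decode (ρ d))      ≡⟨ cong (λ u → true ∷ true ∷ path 2 (decode u)) eq ⟩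
  true ∷ true ∷ path 2 (decode (ρ d′))     ≡⟨ sym (F-from-ρ n d′ inF′) ⟩
  d′                                       ∎

pyramid : ℕ → Word
pyramid b = replicate (suc b) true ++ replicate (suc b) false

-- A Dyck path from height h that is a prefix of 1^a 0^(a+h) and is not the
-- trivial empty path is the whole word: the pyramid meets height 0 only at its end.
pyramid-prefix : ∀ {h y} → DyckFrom h y → ∀ a z → replicate a true ++ replicate (a + h) false ≡ y ++ z →
  0 < h ⊎ y ≢ [] → z ≡ []
pyramid-prefix done a z eq (inj₁ ())
pyramid-prefix done a z eq (inj₂ y≢[]) = ⊥-elim (y≢[] refl)
pyramid-prefix (up {zero} D)  zero z () _
pyramid-prefix (up {suc h} D) zero z () _
pyramid-prefix (up {h} D) (suc a) z eq _ =
  pyramid-prefix D a z (trans (cong (λ k → replicate a true ++ replicate k false) (+-suc a h)) (∷-injectiveʳ eq))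
                 (inj₁ (s≤s z≤n))
pyramid-prefix (down D) (suc a) z () _
pyramid-prefix (down {zero} {[]} D)    zero z eq _ = sym (∷-injectiveʳ eq)
pyramid-prefix (down {zero} {b ∷ y} D) zero z eq _ = pyramid-prefix D zero z (∷-injectiveʳ eq) (inj₂ (λ ()))
pyramid-prefix (down {suc h} D)        zero z eq _ = pyramid-prefix D zero z (∷-injectiveʳ eq) (inj₁ (s≤s z≤n))

ups-Dyck : ∀ a h w → DyckFrom (a + h) w → DyckFrom h (replicate a true ++ w)
ups-Dyck zero    h w D = D
ups-Dyck (suc a) h w D = up (ups-Dyck a (suc h) w (subst (λ k → DyckFrom k w) (sym (+-suc a h)) D))

pyramid-primitive : ∀ b → Primitive (pyramid b)
pyramid-primitive b =
  ups-Dyck (suc b) 0 _ (subst (λ k → DyckFrom k (replicate (suc b) false)) (sym (+-identityʳ (suc b))) (descent-Dyck (suc b))) ,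
  λ y z eq Dy _ y≢[] z≢[] → z≢[] (pyramid-prefix Dy (suc b) z
    (trans (cong (λ k → replicate (suc b) true ++ replicate k false) (+-identityʳ (suc b))) eq) (inj₂ y≢[]))

path-pyramid : ∀ v e b X →
  true ∷ path (e + suc v) (replicate b rise ++ valley v ∷ X) ≡ pyramid b ++ replicate e false ++ true ∷ path (suc v) X
path-pyramid v e b X = cong (true ∷_) (begin
  path (e + suc v) (replicate b rise ++ valley v ∷ X)
    ≡⟨ path-rises (e + suc v) b (valley v ∷ X) ⟩
  replicate b true ++ replicate (b + (e + suc v) ∸ v) false ++ s
    ≡⟨ cong (λ k → replicate b true ++ replicate k false ++ s) descent ⟩
  replicate b true ++ replicate (suc b + e) false ++ s
    ≡⟨ cong (replicate b true ++_) (sym (replicate-++ (suc b) e false s)) ⟩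
  replicate b true ++ replicate (suc b) false ++ replicate e false ++ s
    ≡⟨ sym (++-assoc (replicate b true) (replicate (suc b) false) _) ⟩
  (replicate b true ++ replicate (suc b) false) ++ replicate e false ++ s ∎)
  where
  s : Word
  s = true ∷ path (suc v) X
  descent : b + (e + suc v) ∸ v ≡ suc b + e
  descent = trans (cong (_∸ v) (begin
    b + (e + suc v)   ≡⟨ cong (b +_) (+-suc e v) ⟩
    b + suc (e + v)   ≡⟨ +-suc b (e + v) ⟩
    suc (b + (e + v)) ≡⟨ cong suc (sym (+-assoc b e v)) ⟩
    suc (b + e) + v   ∎)) (m+n∸n≡m (suc b + e) v)

fromTokens-split : ∀ A → ∃ λ p → ∀ X → fromTokens (A ++ X) ≡ p ++ true ∷ path (height 2 A) X
fromTokens-split A with path-split 2 A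
... | p , split = true ∷ p , λ X → cong (true ∷_) (split X)

-- Merging two valleys at height h: the pyramid between them is moved up to the
-- top of the preceding ascent, turning the first valley into a rise.
cover-merge : ∀ A h b X → h < height 2 A →
  DexCover (fromTokens (A ++ valley h ∷ replicate b rise ++ valley h ∷ X))
           (fromTokens (A ++ rise ∷ replicate b rise ++ valley h ∷ X))
cover-merge A h b X h<H with fromTokens-split A
... | p , split =
  cover p (pyramid b) (true ∷ path (suc h) X) (H ∸ h) 0 (H ∸ h) (m<n⇒0<n∸m h<H) (pyramid-primitive b) (inj₂ (_ , refl))
        refl (m<n⇒0<n∸m h<H)
        (trans (split _) (cong (λ w → p ++ true ∷ replicate (H ∸ h) false ++ w) (path-pyramid h 0 b X)))
        (trans (split _) (cong (λ w → p ++ true ∷ w)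
                                 (trans (cong (λ k → true ∷ path k B) (sym H-split)) (path-pyramid h (H ∸ h) b X))))
  where
  H : ℕ
  H = height 2 A
  B : List Tok
  B = replicate b rise ++ valley h ∷ X
  H-split : H ∸ h + suc h ≡ suc H
  H-split = trans (+-suc (H ∸ h) h) (cong suc (m∸n+n≡m (<⇒≤ h<H)))

SuffixZero : List Tok → Set
SuffixZero X = X ≡ [] ⊎ ∃₂ λ b X′ → X ≡ replicate b rise ++ valley 0 ∷ X′

-- Raising a valley from height 0 to 1: the pyramid after it moves up by one step.
raise-at : ∀ p H X → SuffixZero X →
  DexCover (p ++ true ∷ path (suc H) (valley 0 ∷ X)) (p ++ true ∷ path (suc H) (valley 1 ∷ X))
raise-at p H .[] (inj₁ refl) =
  cover p (pyramid 0) [] (suc H) H 1 (s≤s z≤n) (pyramid-primitive 0) (inj₁ refl) (+-comm H 1) (s≤s z≤n) refl refl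
raise-at p H .(replicate b rise ++ valley 0 ∷ X) (inj₂ (b , X , refl)) =
  cover p (pyramid b) (true ∷ path 1 X) (suc H) H 1 (s≤s z≤n) (pyramid-primitive b) (inj₂ (_ , refl)) (+-comm H 1) (s≤s z≤n)
        (cong (λ w → p ++ true ∷ replicate (suc H) false ++ w) (path-pyramid 0 0 b X))
        (cong (λ w → p ++ true ∷ replicate H false ++ w) (path-pyramid 0 1 b X))

cover-raise : ∀ A X → SuffixZero X → DexCover (fromTokens (A ++ valley 0 ∷ X)) (fromTokens (A ++ valley 1 ∷ X))
cover-raise A X sz with fromTokens-split A
... | p , split with height 2 A | height-pos 1 A
... | suc H | _ = subst₂ DexCover (sym (split _)) (sym (split _)) (raise-at p H X sz)

record _↝_ (T T′ : List Tok) : Set where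
  constructor chain
  field below : fromTokens T ≼Dex fromTokens T′
open _↝_

infixr 5 _◅↝_ _⟫_

↝-refl : ∀ {T} → T ↝ T
↝-refl = chain ε

_◅↝_ : ∀ {T₁ T₂ T₃} → DexCover (fromTokens T₁) (fromTokens T₂) → T₂ ↝ T₃ → T₁ ↝ T₃
c ◅↝ chain r = chain (c ◅ r)

single : ∀ {T T′} → DexCover (fromTokens T) (fromTokens T′) → T ↝ T′
single c = c ◅↝ ↝-refl

_⟫_ : ∀ {T₁ T₂ T₃} → T₁ ↝ T₂ → T₂ ↝ T₃ → T₁ ↝ T₃
chain r ⟫ chain r′ = chain (r ◅◅ r′)

↝-cast : ∀ {T₁ T₁′ T₂ T₂′} → T₁ ≡ T₁′ → T₂ ≡ T₂′ → T₁ ↝ T₂ → T₁′ ↝ T₂′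
↝-cast refl refl r = r

suffixZero-blocks : ∀ ls → SuffixZero (blocks 0 ls)
suffixZero-blocks []       = inj₁ refl
suffixZero-blocks (l ∷ ls) = inj₂ (l , blocks 0 ls , refl)

merge-run : ∀ A h l X → h < height 2 A →
  (A ++ replicate (suc l) (valley h) ++ X) ↝ (A ++ replicate l rise ++ valley h ∷ X)
merge-run A h zero    X h<H = ↝-refl
merge-run A h (suc l) X h<H =
  cover-merge A h 0 (replicate l (valley h) ++ X) h<H ◅↝
  ↝-cast (++-assoc A (rise ∷ []) _) (++-assoc A (rise ∷ []) _) (merge-run (A ++ rise ∷ []) h l X h<H′)
  where
  h<H′ : h < height 2 (A ++ rise ∷ [])
  h<H′ = subst (h <_) (sym (height-++ 2 A (rise ∷ []))) (≤-trans h<H (n≤1+n _))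

merge-blocks : ∀ A h ls X → h < height 2 A → (A ++ replicate (size ls) (valley h) ++ X) ↝ (A ++ blocks h ls ++ X)
merge-blocks A h []       X h<H = ↝-refl
merge-blocks A h (l ∷ ls) X h<H =
  ↝-cast runs (++-assoc A (replicate (suc l) (valley h)) _) (merge-blocks (A ++ replicate (suc l) (valley h)) h ls X h<H′) ⟫
  ↝-cast refl (cong (A ++_) (sym (++-assoc (replicate l rise) (valley h ∷ blocks h ls) X))) (merge-run A h l (blocks h ls ++ X) h<H)
  where
  h<H′ : h < height 2 (A ++ replicate (suc l) (valley h))
  h<H′ = subst (h <_) (sym (trans (height-++ 2 A _) (height-valleys (height 2 A) h l))) ≤-refl
  runs : (A ++ replicate (suc l) (valley h)) ++ replicate (size ls) (valley h) ++ X ≡ A ++ replicate (size (l ∷ ls)) (valley h) ++ X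
  runs = trans (++-assoc A _ _) (cong (A ++_) (replicate-++ (suc l) (size ls) (valley h) X))

raise-run : ∀ A k X → SuffixZero X → (A ++ replicate k (valley 0) ++ X) ↝ (A ++ replicate k (valley 1) ++ X)
raise-run A zero    X _  = ↝-refl
raise-run A (suc k) X sz =
  cover-raise A (replicate k (valley 0) ++ X) (suffix k) ◅↝
  ↝-cast (++-assoc A (valley 1 ∷ []) _) (++-assoc A (valley 1 ∷ []) _) (raise-run (A ++ valley 1 ∷ []) k X sz)
  where
  suffix : ∀ k → SuffixZero (replicate k (valley 0) ++ X)
  suffix zero    = sz
  suffix (suc k) = inj₂ (0 , _ , refl)

raise-blocks : ∀ ks ls → (blocks 1 ks ++ blocks 0 ls) ↝ blocks 1 (ks ++ ls)
raise-blocks ks [] = ↝-cast refl (trans (++-identityʳ _) (cong (blocks 1) (sym (++-identityʳ ks)))) ↝-refl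
raise-blocks ks (l ∷ ls) =
  ↝-cast (++-assoc (blocks 1 ks) (replicate l rise) _) raised
         (single (cover-raise (blocks 1 ks ++ replicate l rise) (blocks 0 ls) (suffixZero-blocks ls))) ⟫
  ↝-cast refl (cong (blocks 1) (++-assoc ks (l ∷ []) ls)) (raise-blocks (ks ++ l ∷ []) ls)
  where
  raised : (blocks 1 ks ++ replicate l rise) ++ valley 1 ∷ blocks 0 ls ≡ blocks 1 (ks ++ l ∷ []) ++ blocks 0 ls
  raised = begin
    (blocks 1 ks ++ replicate l rise) ++ valley 1 ∷ blocks 0 ls
      ≡⟨ ++-assoc (blocks 1 ks) (replicate l rise) _ ⟩
    blocks 1 ks ++ replicate l rise ++ valley 1 ∷ blocks 0 ls
      ≡⟨ cong (blocks 1 ks ++_) (sym (++-assoc (replicate l rise) (valley 1 ∷ []) _)) ⟩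
    blocks 1 ks ++ (replicate l rise ++ valley 1 ∷ []) ++ blocks 0 ls
      ≡⟨ sym (++-assoc (blocks 1 ks) _ _) ⟩
    (blocks 1 ks ++ replicate l rise ++ valley 1 ∷ []) ++ blocks 0 ls
      ≡⟨ cong (_++ blocks 0 ls) (sym (blocks-snoc 1 ks l)) ⟩
    blocks 1 (ks ++ l ∷ []) ++ blocks 0 ls ∎

merge-top : ∀ k ks → blocks 1 (k ∷ ks) ↝ blocks 1 (k + size ks ∷ [])
merge-top k []        = ↝-cast refl (cong (λ i → blocks 1 (i ∷ [])) (sym (+-identityʳ k))) ↝-refl
merge-top k (k′ ∷ ks) =
  cover-merge (replicate k rise) 1 k′ (blocks 1 ks) 1<H ◅↝
  ↝-cast (sym (replicate-++ k (suc k′) rise _)) (cong (λ i → blocks 1 (i ∷ [])) (+-assoc k (suc k′) (size ks)))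
         (merge-top (k + suc k′) ks)
  where
  1<H : 1 < height 2 (replicate k rise)
  1<H = subst (1 <_) (sym (trans (height-rises 2 k) (+-comm k 2))) (s≤s (s≤s z≤n))

-- From the bottom: split the valleys at height 0 into the runs for ks and ls,
-- group the second run into blocks, raise the first run to height 1 and group it.
from-bottom : ∀ n ks ls → size ks + size ls ≡ suc n → replicate (suc n) (valley 0) ↝ (blocks 1 ks ++ blocks 0 ls)
from-bottom n ks ls sizes =
  ↝-cast runs (cong (A ++_) (++-identityʳ (blocks 0 ls))) (merge-blocks A 0 ls [] (height-pos 1 A)) ⟫
  raise-run [] (size ks) (blocks 0 ls) (suffixZero-blocks ls) ⟫
  merge-blocks [] 1 ks (blocks 0 ls) ≤-refl
  where
  A : List Tok
  A = replicate (size ks) (valley 0)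
  runs : A ++ replicate (size ls) (valley 0) ++ [] ≡ replicate (suc n) (valley 0)
  runs = trans (replicate-++ (size ks) (size ls) (valley 0) [])
               (trans (++-identityʳ _) (cong (λ k → replicate k (valley 0)) sizes))

reaches-top : ∀ n ks ls → size ks + size ls ≡ suc n → (blocks 1 ks ++ blocks 0 ls) ↝ blocks 1 (n ∷ [])
reaches-top n ks ls sizes = raise-blocks ks ls ⟫ merge-all (ks ++ ls) (trans (size-++ ks ls) sizes)
  where
  merge-all : ∀ xs → size xs ≡ suc n → blocks 1 xs ↝ blocks 1 (n ∷ [])
  merge-all (k ∷ xs) size-xs = ↝-cast refl (cong (λ i → blocks 1 (i ∷ [])) (suc-injective size-xs)) (merge-top k xs)

blocks-in-F : ∀ n ks ls → size ks + size ls ≡ suc n → InF (suc n) (fromTokens (blocks 1 ks ++ blocks 0 ls))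
blocks-in-F n ks ls sizes = (dyck , len) , bottom≼ , ≼top
  where
  T : List Tok
  T = blocks 1 ks ++ blocks 0 ls
  dyck : IsDyck (fromTokens T)
  dyck = path-Dyck 0 (rise ∷ rise ∷ T) (admissible-blocks ks ls)
  ups-T : ups (fromTokens T) ≡ suc n + 2
  ups-T = begin
    ups (fromTokens T)                          ≡⟨ ups-path 0 (rise ∷ rise ∷ T) ⟩
    2 + length T                                ≡⟨ cong (2 +_) (length-++ (blocks 1 ks)) ⟩
    2 + (length (blocks 1 ks) + length (blocks 0 ls)) ≡⟨ cong (2 +_) (cong₂ _+_ (length-blocks 1 ks) (length-blocks 0 ls)) ⟩
    2 + (size ks + size ls)                     ≡⟨ cong (2 +_) sizes ⟩
    2 + suc n                                   ≡⟨ +-comm 2 (suc n) ⟩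
    suc n + 2                                   ∎
  len : length (fromTokens T) ≡ 2 * (suc n + 2)
  len = trans (length-Dyck dyck) (cong (2 *_) ups-T)
  bottom≼ : botF (suc n) ≼Dex fromTokens T
  bottom≼ = subst (_≼Dex fromTokens T) (sym (bottom-tokens (suc n))) (below (from-bottom n ks ls sizes))
  ≼top : fromTokens T ≼Dex topF (suc n)
  ≼top = subst (fromTokens T ≼Dex_) (sym (top-tokens n)) (below (reaches-top n ks ls sizes))

encode-blocks : ∀ c k ks Y → encode 0 (blocks c (k ∷ ks) ++ Y) ≡ c ∷ replicate k 2 ++ encode 0 (blocks c ks ++ Y)
encode-blocks c k ks Y = begin
  encode 0 ((replicate k rise ++ valley c ∷ blocks c ks) ++ Y)
    ≡⟨ cong (encode 0) (++-assoc (replicate k rise) _ Y) ⟩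
  encode 0 (replicate k rise ++ valley c ∷ blocks c ks ++ Y)
    ≡⟨ encode-rises 0 k _ ⟩
  encode (k + 0) (valley c ∷ blocks c ks ++ Y)
    ≡⟨ cong (λ j → encode j (valley c ∷ blocks c ks ++ Y)) (+-identityʳ k) ⟩
  c ∷ replicate k 2 ++ encode 0 (blocks c ks ++ Y) ∎

encode-blocks₀ : ∀ c k ks → encode 0 (blocks c (k ∷ ks)) ≡ c ∷ replicate k 2 ++ encode 0 (blocks c ks)
encode-blocks₀ c k ks = begin
  encode 0 (blocks c (k ∷ ks))
    ≡⟨ cong (encode 0) (sym (++-identityʳ (blocks c (k ∷ ks)))) ⟩
  encode 0 (blocks c (k ∷ ks) ++ [])
    ≡⟨ encode-blocks c k ks [] ⟩
  c ∷ replicate k 2 ++ encode 0 (blocks c ks ++ [])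
    ≡⟨ cong (λ X → c ∷ replicate k 2 ++ encode 0 X) (++-identityʳ (blocks c ks)) ⟩
  c ∷ replicate k 2 ++ encode 0 (blocks c ks) ∎

-- After a letter 0, a word of Tr consists of letters 0 and 2: blocks closed at height 0.
parse-zeros : ∀ r → All (_≢ 1) r → All (_≤ 2) r → ∃₂ λ l ls → 0 ∷ r ≡ encode 0 (blocks 0 (l ∷ ls))
parse-zeros []                    _          _          = 0 , [] , refl
parse-zeros (zero ∷ r)            (_ ∷ no1)  (_ ∷ b)    with parse-zeros r no1 b
... | l , ls , e = 0 , l ∷ ls , cong (0 ∷_) e
parse-zeros (suc zero ∷ r)        (≢1 ∷ _)   _          = ⊥-elim (≢1 refl)
parse-zeros (suc (suc zero) ∷ r)  (_ ∷ no1)  (_ ∷ b)    with parse-zeros r no1 b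
... | l , ls , e = suc l , ls , (begin
  0 ∷ 2 ∷ r
    ≡⟨ cong (λ z → 0 ∷ 2 ∷ z) (∷-injectiveʳ (trans e (encode-blocks₀ 0 l ls))) ⟩
  0 ∷ 2 ∷ replicate l 2 ++ encode 0 (blocks 0 ls)
    ≡⟨ sym (encode-blocks₀ 0 (suc l) ls) ⟩
  encode 0 (blocks 0 (suc l ∷ ls)) ∎)
parse-zeros (suc (suc (suc x)) ∷ r) _        (s≤s (s≤s ()) ∷ _)

parse-ones : ∀ r → All (_≤ 2) r → NoZeroBeforeOne r →
  ∃ λ k → ∃₂ λ ks ls → 1 ∷ r ≡ encode 0 (blocks 1 (k ∷ ks) ++ blocks 0 ls)
parse-ones []                   _       _          = 0 , [] , [] , refl
parse-ones (zero ∷ r)           (_ ∷ b) (no1 , _)  with parse-zeros r (no1 refl) b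
... | l , ls , e = 0 , [] , l ∷ ls , cong (1 ∷_) e
parse-ones (suc zero ∷ r)       (_ ∷ b) (_ , n)    with parse-ones r b n
... | k , ks , ls , e = 0 , k ∷ ks , ls , cong (1 ∷_) e
parse-ones (suc (suc zero) ∷ r) (_ ∷ b) (_ , n)    with parse-ones r b n
... | k , ks , ls , e = suc k , ks , ls , (begin
  1 ∷ 2 ∷ r
    ≡⟨ cong (λ z → 1 ∷ 2 ∷ z) (∷-injectiveʳ (trans e (encode-blocks 1 k ks _))) ⟩
  1 ∷ 2 ∷ replicate k 2 ++ encode 0 (blocks 1 ks ++ blocks 0 ls)
    ≡⟨ sym (encode-blocks 1 (suc k) ks _) ⟩
  encode 0 (blocks 1 (suc k ∷ ks) ++ blocks 0 ls) ∎)
parse-ones (suc (suc (suc x)) ∷ r) (s≤s (s≤s ()) ∷ _) _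

Tr-decomposition : ∀ u → All (_≤ 2) u → (∀ w → u ≢ 2 ∷ w) → NoZeroBeforeOne u →
  ∃₂ λ ks ls → u ≡ encode 0 (blocks 1 ks ++ blocks 0 ls)
Tr-decomposition []                    _       _    _         = [] , [] , refl
Tr-decomposition (zero ∷ r)            (_ ∷ b) _    (no1 , _) with parse-zeros r (no1 refl) b
... | l , ls , e = [] , l ∷ ls , e
Tr-decomposition (suc zero ∷ r)        (_ ∷ b) _    (_ , n)   with parse-ones r b n
... | k , ks , ls , e = k ∷ ks , ls , e
Tr-decomposition (suc (suc zero) ∷ r)  _       not2 _         = ⊥-elim (not2 r refl)
Tr-decomposition (suc (suc (suc x)) ∷ r) (s≤s (s≤s ()) ∷ _) _ _

ρ-onto : ∀ n u → InTr (suc n) u → ∃ λ d → InF (suc n) d × ρ d ≡ u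
ρ-onto n u (len , bounded , not2 , positional)
  with Tr-decomposition u bounded not2 (positional⇒NoZeroBeforeOne u positional)
... | ks , ls , u≡ = fromTokens T , blocks-in-F n ks ls sizes , ρ-path
  where
  T : List Tok
  T = blocks 1 ks ++ blocks 0 ls
  nonempty : ks ≡ [] → ls ≡ [] → ⊥
  nonempty refl refl with trans (sym len) (cong length u≡)
  ... | ()
  sizes : size ks + size ls ≡ suc n
  sizes = begin
    size ks + size ls                          ≡⟨ sym (cong₂ _+_ (length-blocks 1 ks) (length-blocks 0 ls)) ⟩
    length (blocks 1 ks) + length (blocks 0 ls) ≡⟨ sym (length-++ (blocks 1 ks)) ⟩
    length T                                   ≡⟨ sym (encode-length 0 T (proj₂ (good-blocks ks ls nonempty))) ⟩
    length (encode 0 T)                        ≡⟨ cong length (sym u≡) ⟩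
    length u                                   ≡⟨ len ⟩
    suc n                                      ∎
  ρ-path : ρ (fromTokens T) ≡ u
  ρ-path = begin
    ρ (fromTokens T)                     ≡⟨ go-encode true 2 0 (path 2 T) ⟩
    encode 0 (tokens true 2 (path 2 T))  ≡⟨ cong (encode 0) (tokens-path 2 T (admissible-blocks ks ls)) ⟩
    encode 0 T                           ≡⟨ sym u≡ ⟩
    u                                    ∎

lemma1p2 : ∀ (n : ℕ) → 1 ≤ n →
    (∀ d → InF n d → InTr n (ρ d)) ×
    (∀ u → InTr n u → ∃ λ d → InF n d × ρ d ≡ u) ×
    (∀ d d′ → InF n d → InF n d′ → ρ d ≡ ρ d′ → d ≡ d′)
lemma1p2 (suc n) _ = ρ-into-Tr n , ρ-onto n , ρ-injective n
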